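{- Let $c\ge 0$ and $f\ge 1$ be integers, and let $M\colon\{1,\dots,c\}\to\{1,\dots,c+f\}$ be an injective map chosen uniformly at random among all $(c+f)(c+f-1)\cdots(f+1)$ injective maps. Let $R$ be the number of requests made by the faithful man Mr.~$c+1$ (as defined in the context). Then for every integer $i$ with $1\le i\le c+1$, \[ \Pr(R=i)=\frac{\binom{f+c-i}{f-1}}{\binom{c+f}{c}} . \] Moreover the mean of $R$ is $\frac{c+f+1}{f+1}$ and its variance is $\frac{(c+f+1)cf}{(f+1)^2(f+2)}$.
   Context: Model (the Garsia–Milne "village"): there are men Mr.~$1,\dots,$ Mr.~$c+f$ and women Mrs.~$1,\dots,$ Mrs.~$c+f$, Mr.~$j$ being married to Mrs.~$j$. Men $1,\dots,c$ are "cheating" and men $c+1,\dots,c+f$ are "faithful". The map $M$ is injective; Mrs.~$M(j)$ is the mistress of Mr.~$j$ for $1\le j\le c$, and conversely Mr.~$j$ is the lover of Mrs.~$M(j)$. A woman is cheating if she lies in the image of $M$, faithful otherwise (there are exactly $f$ faithful women). The matching procedure for a faithful man $m$: he first asks his wife Mrs.~$m$. Whenever he asks a woman Mrs.~$w$: if $w$ is not in the image of $M$ she accepts and the procedure stops; otherwise he next asks Mrs.~$M^{ -1}(w)$ (the wife of her lover). The number of requests of $m$ is the total number of women he asks, including the final accepting one. -}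

module Defs where

open import Data.Nat using (ℕ; zero; suc; _+_; _≤_; s≤s; z≤n)
open import Data.Fin using (Fin; zero; suc; _↑ˡ_; _↑ʳ_; _≟_)
open import Data.Fin.Properties using (all?)
open import Data.Maybe using (Maybe; nothing; just)
import Data.Maybe as Maybe
open import Data.List using (List; []; _∷_; [_]; map; concatMap; filter; length; foldr)
open import Data.List using () renaming (allFin to allFinL)
open import Data.Vec.Functional using () renaming (_∷_ to _∷ᶠ_)
open import Data.Integer using (+_)
open import Data.Rational using (ℚ; _/_; 0ℚ; 1ℚ; _*_; _-_) renaming (_+_ to _+ℚ_)
open import Function using (_∘_)
open import Function.Definitions using (Injective)
open import Relation.Binary.PropositionalEquality using (_≡_)
open import Relation.Nullary using (Dec; yes; no; _→-dec_)
open import Relation.Nullary.Decidable using (map′)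

-- Women Mrs. 1 .. Mrs. n are represented by Fin n (Mrs. k ↦ index k-1),
-- cheating men Mr. 1 .. Mr. c by Fin c, and a map M : {1..c} → {1..c+f}
-- by a function Fin c → Fin (c + f).  Mr. j (j ≤ c) is married to the woman
-- with the same index, i.e. j ↑ˡ f.

allFuns : (k n : ℕ) → List (Fin k → Fin n)
allFuns zero    n = [ (λ ()) ]
allFuns (suc k) n = concatMap (λ x → map (λ g → x ∷ᶠ g) (allFuns k n)) (allFinL n)

injective? : ∀ {k n} (M : Fin k → Fin n) → Dec (Injective _≡_ _≡_ M)
injective? M =
  map′ (λ h {x} {y} → h x y) (λ h x y → h {x} {y})
       (all? (λ x → all? (λ y → (M x ≟ M y) →-dec (x ≟ y))))

injections : (c f : ℕ) → List (Fin c → Fin (c + f))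
injections c f = filter injective? (allFuns c (c + f))

-- The (first, and for injective M the unique) preimage of a woman under M,
-- or nothing if she is not in the image of M (i.e. she is faithful).
preimage : ∀ {c n} → (Fin c → Fin n) → Fin n → Maybe (Fin c)
preimage {zero}  M w = nothing
preimage {suc c} M w with M zero ≟ w
... | yes _ = just zero
... | no  _ = Maybe.map suc (preimage (M ∘ suc) w)

-- Number of requests when the man is about to ask woman w, with a fuel
-- bound on the number of women asked.  Each step: if w is not in the image
-- of M she accepts (count 1 and stop); else ask the wife of her lover.
requestsFrom : ∀ {c f} → ℕ → (Fin c → Fin (c + f)) → Fin (c + f) → ℕ
requestsFrom zero          M w = zero
requestsFrom {c} {f} (suc k) M w with preimage M w
... | nothing = 1
... | just j  = suc (requestsFrom k M (j ↑ˡ f))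

-- Mr. c+1, a faithful man (requires f ≥ 1); as a woman-index, his wife Mrs. c+1.
mrCPlus1 : (c f : ℕ) → 1 ≤ f → Fin (c + f)
mrCPlus1 c (suc g) _ = c ↑ʳ zero

-- For injective M the procedure never asks the same woman twice, so
-- it terminates within c + f requests; the fuel c + f is therefore never
-- exhausted.
R : (c f : ℕ) → 1 ≤ f → (Fin c → Fin (c + f)) → ℕ
R c f h M = requestsFrom (c + f) M (mrCPlus1 c f h)

ℕtoℚ : ℕ → ℚ
ℕtoℚ n = (+ n) / 1

-- q / n for n a natural number (n = 0 never occurs below; it gives 0).
_/ℕ_ : ℚ → ℕ → ℚ
q /ℕ zero    = 0ℚ
q /ℕ (suc n) = q * ((+ 1) / suc n)

sumℚ : List ℚ → ℚ
sumℚ = foldr _+ℚ_ 0ℚ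

expect : ∀ {A : Set} → List A → (A → ℚ) → ℚ
expect Ω X = sumℚ (map X Ω) /ℕ length Ω

prob : ∀ {A : Set} → List A → (A → ℕ) → ℕ → ℚ
prob Ω X i = expect Ω (λ a → indicator (X a))
  where
  indicator : ℕ → ℚ
  indicator x with x Data.Nat.≟ i
  ... | yes _ = 1ℚ
  ... | no  _ = 0ℚ

variance : ∀ {A : Set} → List A → (A → ℚ) → ℚ
variance Ω X = expect Ω (λ a → (X a - μ) * (X a - μ))
  where μ = expect Ω X

{-# OPTIONS --safe #-}
module Submission where

-- Every injection on c + 1 men arises once as x ∷ skip x ∘ h from an injection h on c men: the
-- new Mr. 0 takes Mrs. x as mistress and the other mistresses are moved by skip x.  A faithful man
-- then asks the women he asked under h (shifted by one), except that right after Mrs. x he detours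
-- through Mrs. 0; so his number of requests R grows by one for the R values of x on his old chain
-- and stays put for the other c + f + 1 − R.  Hence Σ_M q (R M) evolves with c like the expectation
-- of q (R) for a Pólya urn started with one red and f black balls, R counting the red balls.  The
-- rising factorials r (r + 1) ⋯ (r + p − 1) are eigenfunctions of one urn step, which gives the mean
-- and the variance; the same recursion applied to the indicators of R = i gives the distribution.

open import Defs
open import Data.Bool using (true; false; if_then_else_)
open import Data.Fin using (Fin; zero; suc; _↑ˡ_; _↑ʳ_; splitAt)
open import Data.Fin.Properties
  using (_≟_; all?; suc-injective; 0≢1+n; ↑ˡ-injective; splitAt-↑ˡ; splitAt-↑ʳ; injective⇒≤)
import Data.Integer as ℤ
import Data.Integer.Properties as ℤ
open import Data.List using (List; []; _∷_; _++_; map; length; filter; concatMap)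
  renaming (allFin to allFinL; tabulate to tabulateL; lookup to lookupL)
open import Data.List.Membership.Propositional using (_∈_; _∉_)
open import Data.List.Membership.Propositional.Properties using (∈-lookup)
open import Data.List.Properties using (map-++; map-∘; map-cong; length-map)
open import Data.List.Relation.Unary.All as All using (All; []; _∷_)
open import Data.List.Relation.Unary.All.Properties using (All¬⇒¬Any; ¬Any⇒All¬)
open import Data.List.Relation.Unary.Any using (here; there)
open import Data.List.Relation.Unary.Unique.Propositional using (Unique; []; _∷_)
import Data.List.Relation.Unary.Unique.Propositional.Properties as Unique
import Data.Maybe as Maybe
open import Data.Maybe using (just; nothing)
open import Data.Nat using (ℕ; zero; suc; pred; _+_; _*_; _∸_; _≤_; _<_; s≤s; s≤s⁻¹; z≤n; _!; NonZero)
open import Data.Nat.Combinatorics using (_C_; k![n∸k]!∣n!)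
open import Data.Nat.Combinatorics.Specification using (nCk≡n!/k![n-k]!)
open import Data.Nat.Divisibility using (_∣_)
open import Data.Nat.DivMod using (_/_; m/n*n≡m)
import Data.Nat.ListAction as List
open import Data.Nat.ListAction.Properties using (sum-++)
open import Data.Nat.Properties using () renaming (_≟_ to _≟ℕ_)
open import Data.Nat.Properties
  using ( +-identityʳ; *-identityʳ; *-zeroʳ; +-suc; +-comm; +-assoc; *-assoc; *-comm; +-cancelʳ-≡
        ; *-cancelʳ-≡; m∸n+n≡m; m+n∸n≡m; m+n∸m≡n; +-∸-assoc; m+[n∸m]≡n; ≤-refl; ≤-reflexive; ≤-trans
        ; ≤-<-trans; <⇒≢; m≤m+n; m≤n⇒m≤1+n; +-monoʳ-≤; 1+n≰n; n>0⇒n≢0; 1≤n!; m*n≢0; _!≢0; _!*_!≢0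
        ; +-*-semiring)
open import Algebra.Properties.Semiring.Sum +-*-semiring
  using (sum-cong-≗; sum-syntax; sum-replicate-zero; ∑-comm; ∑-distrib-+; *-distribˡ-sum; *-distribʳ-sum)
open import Data.Nat.Tactic.RingSolver using (solve-∀)
open import Data.Product using (Σ; _×_; _,_; proj₁; proj₂; ∃; ∃₂)
open import Data.Rational using (ℚ; 0ℚ; 1ℚ; toℚᵘ)
  renaming (_+_ to _+ℚ_; _*_ to _*ℚ_; _-_ to _-ℚ_)
import Data.Rational as ℚ using (_/_)
import Data.Rational.Properties as ℚ
open import Data.Rational.Solver using (module +-*-Solver)
open import Data.Rational.Unnormalised using (mkℚᵘ; *≡*)
import Data.Rational.Unnormalised as ℚᵘ using (_+_; _*_)
import Data.Rational.Unnormalised.Properties as ℚᵘ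
open import Data.Sum using (_⊎_; inj₁; inj₂)
open import Data.Vec.Functional using () renaming (_∷_ to _∷ᶠ_)
open import Function using (_∘_; _⇔_; mk⇔)
open import Function.Definitions using (Injective)
open import Relation.Binary.PropositionalEquality
open import Relation.Nullary using (Dec; yes; no; does; ¬_; ¬?; _×-dec_)
open import Relation.Nullary.Decidable using (does-⇔; dec-true; dec-false)
open import Relation.Nullary.Negation using (contradiction)

variable
  c f k n : ℕ

-- Indicators and finite sums

𝟙 : {P : Set} → Dec P → ℕ
𝟙 P? = if does P? then 1 else 0

𝟙-⇔ : {P Q : Set} → P ⇔ Q → (P? : Dec P) (Q? : Dec Q) → 𝟙 P? ≡ 𝟙 Q?
𝟙-⇔ P⇔Q P? Q? = cong (λ b → if b then 1 else 0) (does-⇔ P⇔Q P? Q?)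

𝟙-yes : {P : Set} → P → (P? : Dec P) → 𝟙 P? ≡ 1
𝟙-yes p P? = cong (λ b → if b then 1 else 0) (dec-true P? p)

𝟙-no : {P : Set} → ¬ P → (P? : Dec P) → 𝟙 P? ≡ 0
𝟙-no ¬p P? = cong (λ b → if b then 1 else 0) (dec-false P? ¬p)

𝟙-×-dec : {P Q : Set} (P? : Dec P) (Q? : Dec Q) → 𝟙 (P? ×-dec Q?) ≡ 𝟙 P? * 𝟙 Q?
𝟙-×-dec P? Q? with does P? | does Q?
... | true  | true  = refl
... | true  | false = refl
... | false | _     = refl

*-𝟙-≟ : ∀ (g : ℕ → ℕ) r i → g r * 𝟙 (r ≟ℕ i) ≡ g i * 𝟙 (r ≟ℕ i)
*-𝟙-≟ g r i with r ≟ℕ i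
... | yes refl = refl
... | no  r≢i  = begin
  g r * 𝟙 (r ≟ℕ i) ≡⟨ cong (g r *_) (𝟙-no r≢i (r ≟ℕ i)) ⟩
  g r * 0          ≡⟨ *-zeroʳ (g r) ⟩
  0                ≡⟨ *-zeroʳ (g i) ⟨
  g i * 0          ≡⟨ cong (g i *_) (𝟙-no r≢i (r ≟ℕ i)) ⟨
  g i * 𝟙 (r ≟ℕ i) ∎
  where open ≡-Reasoning

∑-𝟙-≟ : (y : Fin n) → ∑[ x < n ] 𝟙 (x ≟ y) ≡ 1
∑-𝟙-≟ {suc n} zero    = cong suc (sum-replicate-zero n)
∑-𝟙-≟ {suc n} (suc y) = ∑-𝟙-≟ y

∑-1 : ∀ n → ∑[ x < n ] 1 ≡ n
∑-1 zero    = refl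
∑-1 (suc n) = cong suc (∑-1 n)

sum-map-1 : ∀ {A : Set} (xs : List A) → List.sum (map (λ _ → 1) xs) ≡ length xs
sum-map-1 []       = refl
sum-map-1 (_ ∷ xs) = cong suc (sum-map-1 xs)

sum-map-concatMap : ∀ {A B : Set} (G : B → ℕ) (F : A → List B) xs →
  List.sum (map G (concatMap F xs)) ≡ List.sum (map (λ a → List.sum (map G (F a))) xs)
sum-map-concatMap G F []       = refl
sum-map-concatMap G F (x ∷ xs) = begin
  List.sum (map G (F x ++ concatMap F xs))
    ≡⟨ cong List.sum (map-++ G (F x) (concatMap F xs)) ⟩
  List.sum (map G (F x) ++ map G (concatMap F xs))
    ≡⟨ sum-++ (map G (F x)) (map G (concatMap F xs)) ⟩
  List.sum (map G (F x)) + List.sum (map G (concatMap F xs))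
    ≡⟨ cong (List.sum (map G (F x)) +_) (sum-map-concatMap G F xs) ⟩
  List.sum (map G (F x)) + List.sum (map (λ a → List.sum (map G (F a))) xs) ∎
  where open ≡-Reasoning

sum-map-tabulate : ∀ {A : Set} (H : A → ℕ) (t : Fin n → A) →
                   List.sum (map H (tabulateL t)) ≡ ∑[ y < n ] H (t y)
sum-map-tabulate {zero}  H t = refl
sum-map-tabulate {suc n} H t = cong (H (t zero) +_) (sum-map-tabulate H (t ∘ suc))

sum-map-filter : ∀ {A : Set} {P : A → Set} (P? : ∀ a → Dec (P a)) (G : A → ℕ) xs →
  List.sum (map G (filter P? xs)) ≡ List.sum (map (λ a → 𝟙 (P? a) * G a) xs)
sum-map-filter P? G []       = refl
sum-map-filter P? G (x ∷ xs) with does (P? x)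
... | true  = cong₂ _+_ (sym (+-identityʳ (G x))) (sum-map-filter P? G xs)
... | false = sum-map-filter P? G xs

-- Sums over maps and over injections

sumMaps : ((Fin k → Fin n) → ℕ) → ℕ
sumMaps {zero}      G = G (λ ())
sumMaps {suc k} {n} G = ∑[ y < n ] sumMaps (λ g → G (y ∷ᶠ g))

Extensional : ((Fin k → Fin n) → ℕ) → Set
Extensional G = ∀ {g h} → g ≗ h → G g ≡ G h

sumMaps-cong : {G H : (Fin k → Fin n) → ℕ} → (∀ g → G g ≡ H g) → sumMaps G ≡ sumMaps H
sumMaps-cong {zero}  G≗H = G≗H _
sumMaps-cong {suc k} G≗H = sum-cong-≗ (λ y → sumMaps-cong (λ g → G≗H (y ∷ᶠ g)))

sumMaps-*ˡ : ∀ a (G : (Fin k → Fin n) → ℕ) → sumMaps (λ g → a * G g) ≡ a * sumMaps G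
sumMaps-*ˡ {zero}  a G = refl
sumMaps-*ˡ {suc k} a G =
  trans (sum-cong-≗ (λ y → sumMaps-*ˡ a (λ g → G (y ∷ᶠ g))))
        (sym (*-distribˡ-sum a (λ y → sumMaps (λ g → G (y ∷ᶠ g)))))

∑-sumMaps-comm : ∀ {p} (G : Fin p → (Fin k → Fin n) → ℕ) →
                 ∑[ x < p ] sumMaps (G x) ≡ sumMaps (λ g → ∑[ x < p ] G x g)
∑-sumMaps-comm {zero}  G = refl
∑-sumMaps-comm {suc k} G =
  trans (∑-comm (λ x y → sumMaps (λ g → G x (y ∷ᶠ g))))
        (sum-cong-≗ (λ y → ∑-sumMaps-comm (λ x g → G x (y ∷ᶠ g))))

sum-map-allFuns : (G : (Fin k → Fin n) → ℕ) → List.sum (map G (allFuns k n)) ≡ sumMaps G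
sum-map-allFuns {zero}      G = +-identityʳ _
sum-map-allFuns {suc k} {n} G = begin
  List.sum (map G (allFuns (suc k) n))
    ≡⟨ sum-map-concatMap G (λ y → map (y ∷ᶠ_) (allFuns k n)) (allFinL n) ⟩
  List.sum (map (λ y → List.sum (map G (map (y ∷ᶠ_) (allFuns k n)))) (allFinL n))
    ≡⟨ sum-map-tabulate (λ y → List.sum (map G (map (y ∷ᶠ_) (allFuns k n)))) (λ y → y) ⟩
  ∑[ y < n ] List.sum (map G (map (y ∷ᶠ_) (allFuns k n)))
    ≡⟨ sum-cong-≗ (λ y → cong List.sum (sym (map-∘ {g = G} {f = y ∷ᶠ_} (allFuns k n)))) ⟩
  ∑[ y < n ] List.sum (map (λ g → G (y ∷ᶠ g)) (allFuns k n))
    ≡⟨ sum-cong-≗ (λ y → sum-map-allFuns (λ g → G (y ∷ᶠ g))) ⟩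
  sumMaps G ∎
  where open ≡-Reasoning

sum-map-injections : (G : (Fin c → Fin (c + f)) → ℕ) →
  List.sum (map G (injections c f)) ≡ sumMaps (λ M → 𝟙 (injective? M) * G M)
sum-map-injections {c} {f} G =
  trans (sum-map-filter injective? G (allFuns c (c + f))) (sum-map-allFuns {c} {c + f} _)

-- skip x : Fin n → Fin (1 + n) misses x and moves only x − 1, to 0: it is suc followed by the
-- transposition of 0 and x.
skip : Fin (suc n) → Fin n → Fin (suc n)
skip x z with suc z ≟ x
... | yes _ = zero
... | no  _ = suc z

skip-hit : ∀ {x} {z : Fin n} → suc z ≡ x → skip x z ≡ zero
skip-hit {x = x} {z} 1+z≡x with suc z ≟ x
... | yes _     = refl
... | no 1+z≢x  = contradiction 1+z≡x 1+z≢x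

skip-miss : ∀ {x} {z : Fin n} → suc z ≢ x → skip x z ≡ suc z
skip-miss {x = x} {z} 1+z≢x with suc z ≟ x
... | yes 1+z≡x = contradiction 1+z≡x 1+z≢x
... | no _      = refl

skip-avoids : ∀ x (z : Fin n) → skip x z ≢ x
skip-avoids x z with suc z ≟ x
... | yes refl  = λ ()
... | no 1+z≢x  = 1+z≢x

skip-injective : ∀ (x : Fin (suc n)) → Injective _≡_ _≡_ (skip x)
skip-injective x {a} {b} with suc a ≟ x | suc b ≟ x
... | yes 1+a≡x | yes 1+b≡x = λ _ → suc-injective (trans 1+a≡x (sym 1+b≡x))
... | yes _     | no _      = λ ()
... | no _      | yes _     = λ ()
... | no _      | no _      = suc-injective

∑-skip : ∀ (x : Fin (suc n)) (K : Fin (suc n) → ℕ) →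
         ∑[ y < suc n ] (𝟙 (¬? (y ≟ x)) * K y) ≡ ∑[ z < n ] K (skip x z)
∑-skip zero         K = sum-cong-≗ (λ z → +-identityʳ (K (suc z)))
∑-skip {n} (suc x′) K = begin
  K zero + 0 + rest
    ≡⟨ cong (_+ rest) (trans (+-identityʳ (K zero)) (sym (*-identityʳ (K zero)))) ⟩
  K zero * 1 + rest
    ≡⟨ cong (λ s → K zero * s + rest) (sym (∑-𝟙-≟ x′)) ⟩
  K zero * ∑[ z < n ] 𝟙 (z ≟ x′) + rest
    ≡⟨ cong (_+ rest) (*-distribˡ-sum (K zero) (λ z → 𝟙 (z ≟ x′))) ⟩
  ∑[ z < n ] (K zero * 𝟙 (z ≟ x′)) + rest
    ≡⟨ sym (∑-distrib-+ (λ z → K zero * 𝟙 (z ≟ x′)) (λ z → 𝟙 (¬? (z ≟ x′)) * K (suc z))) ⟩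
  ∑[ z < n ] (K zero * 𝟙 (z ≟ x′) + 𝟙 (¬? (z ≟ x′)) * K (suc z))
    ≡⟨ sum-cong-≗ split ⟩
  ∑[ z < n ] K (skip (suc x′) z) ∎
  where
  open ≡-Reasoning
  rest : ℕ
  rest = ∑[ z < n ] (𝟙 (¬? (z ≟ x′)) * K (suc z))
  split : ∀ z → K zero * 𝟙 (z ≟ x′) + 𝟙 (¬? (z ≟ x′)) * K (suc z) ≡ K (skip (suc x′) z)
  split z with z ≟ x′
  ... | yes _ = trans (+-identityʳ _) (*-identityʳ (K zero))
  ... | no  _ = trans (cong (_+ (K (suc z) + 0)) (*-zeroʳ (K zero))) (+-identityʳ (K (suc z)))

avoids? : (x : Fin n) (g : Fin k → Fin n) → Dec (∀ j → g j ≢ x)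
avoids? x g = all? (λ j → ¬? (g j ≟ x))

𝟙-avoids-∷ : ∀ (x y : Fin n) (g : Fin k → Fin n) →
             𝟙 (avoids? x (y ∷ᶠ g)) ≡ 𝟙 (¬? (y ≟ x)) * 𝟙 (avoids? x g)
𝟙-avoids-∷ x y g =
  trans (𝟙-⇔ (mk⇔ (λ a → a zero , a ∘ suc) (λ { (b , c) zero → b ; (b , c) (suc j) → c j }))
             (avoids? x (y ∷ᶠ g)) (¬? (y ≟ x) ×-dec avoids? x g))
        (𝟙-×-dec (¬? (y ≟ x)) (avoids? x g))

𝟙-injective-∷ : ∀ (x : Fin n) (g : Fin k → Fin n) →
                𝟙 (injective? (x ∷ᶠ g)) ≡ 𝟙 (avoids? x g) * 𝟙 (injective? g)
𝟙-injective-∷ x g =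
  trans (𝟙-⇔ (mk⇔ split join) (injective? (x ∷ᶠ g)) (avoids? x g ×-dec injective? g))
        (𝟙-×-dec (avoids? x g) (injective? g))
  where
  split : Injective _≡_ _≡_ (x ∷ᶠ g) → (∀ j → g j ≢ x) × Injective _≡_ _≡_ g
  split inj = (λ j gj≡x → 0≢1+n (sym (inj {suc j} {zero} gj≡x))) , (λ gi≡gj → suc-injective (inj gi≡gj))
  join : (∀ j → g j ≢ x) × Injective _≡_ _≡_ g → Injective _≡_ _≡_ (x ∷ᶠ g)
  join (avoid , inj) {zero}  {zero}  _     = refl
  join (avoid , inj) {zero}  {suc j} x≡gj  = contradiction (sym x≡gj) (avoid j)
  join (avoid , inj) {suc i} {zero}  gi≡x  = contradiction gi≡x (avoid i)
  join (avoid , inj) {suc i} {suc j} gi≡gj = cong suc (inj gi≡gj)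

𝟙-injective-cong : {g h : Fin k → Fin n} → g ≗ h → 𝟙 (injective? g) ≡ 𝟙 (injective? h)
𝟙-injective-cong {g = g} {h} g≗h =
  𝟙-⇔ (mk⇔ (λ inj {i} {j} e → inj (trans (g≗h i) (trans e (sym (g≗h j)))))
           (λ inj {i} {j} e → inj (trans (sym (g≗h i)) (trans e (g≗h j)))))
      (injective? g) (injective? h)

𝟙-injective-∘ : ∀ {p} {e : Fin n → Fin p} → Injective _≡_ _≡_ e → (h : Fin k → Fin n) →
                𝟙 (injective? (e ∘ h)) ≡ 𝟙 (injective? h)
𝟙-injective-∘ {e = e} e-inj h =
  𝟙-⇔ (mk⇔ (λ inj {i} {j} eq → inj (cong e eq)) (λ inj {i} {j} eq → inj (e-inj eq)))
      (injective? (e ∘ h)) (injective? h)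

∷-cong : ∀ {A : Set} (y : A) {g h : Fin k → A} → g ≗ h → (y ∷ᶠ g) ≗ (y ∷ᶠ h)
∷-cong y g≗h zero    = refl
∷-cong y g≗h (suc i) = g≗h i

∘-∷ : ∀ {A B : Set} (e : A → B) (z : A) (h : Fin k → A) → (e ∘ (z ∷ᶠ h)) ≗ (e z ∷ᶠ e ∘ h)
∘-∷ e z h zero    = refl
∘-∷ e z h (suc i) = refl

sumMaps-avoiding : ∀ (x : Fin (suc n)) {G : (Fin k → Fin (suc n)) → ℕ} → Extensional G →
  sumMaps (λ g → 𝟙 (avoids? x g) * G g) ≡ sumMaps (λ h → G (skip x ∘ h))
sumMaps-avoiding {n} {k = zero} x {G} ext =
  trans (cong (_* G (λ ())) (𝟙-yes (λ ()) (avoids? {k = 0} x (λ ()))))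
        (trans (+-identityʳ (G (λ ()))) (ext (λ ())))
sumMaps-avoiding {n} {k = suc k} x {G} ext = begin
  ∑[ y < suc n ] sumMaps (λ g → 𝟙 (avoids? x (y ∷ᶠ g)) * G (y ∷ᶠ g))
    ≡⟨ sum-cong-≗ (λ y → sumMaps-cong (λ g →
         trans (cong (_* G (y ∷ᶠ g)) (𝟙-avoids-∷ x y g))
               (*-assoc (𝟙 (¬? (y ≟ x))) (𝟙 (avoids? x g)) (G (y ∷ᶠ g))))) ⟩
  ∑[ y < suc n ] sumMaps (λ g → 𝟙 (¬? (y ≟ x)) * (𝟙 (avoids? x g) * G (y ∷ᶠ g)))
    ≡⟨ sum-cong-≗ (λ y → sumMaps-*ˡ (𝟙 (¬? (y ≟ x))) (λ g → 𝟙 (avoids? x g) * G (y ∷ᶠ g))) ⟩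
  ∑[ y < suc n ] (𝟙 (¬? (y ≟ x)) * sumMaps (λ g → 𝟙 (avoids? x g) * G (y ∷ᶠ g)))
    ≡⟨ sum-cong-≗ (λ y → cong (𝟙 (¬? (y ≟ x)) *_) (sumMaps-avoiding x (ext ∘ ∷-cong y))) ⟩
  ∑[ y < suc n ] (𝟙 (¬? (y ≟ x)) * sumMaps (λ h → G (y ∷ᶠ skip x ∘ h)))
    ≡⟨ ∑-skip x (λ y → sumMaps (λ h → G (y ∷ᶠ skip x ∘ h))) ⟩
  ∑[ z < n ] sumMaps (λ h → G (skip x z ∷ᶠ skip x ∘ h))
    ≡⟨ sum-cong-≗ (λ z → sumMaps-cong (λ h → ext (λ i → sym (∘-∷ (skip x) z h i)))) ⟩
  ∑[ z < n ] sumMaps (λ h → G (skip x ∘ (z ∷ᶠ h))) ∎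
  where open ≡-Reasoning

sumMaps-injections-∷ : {G : (Fin (suc k) → Fin (suc n)) → ℕ} → Extensional G →
  sumMaps (λ M → 𝟙 (injective? M) * G M)
    ≡ ∑[ x < suc n ] sumMaps (λ h → 𝟙 (injective? h) * G (x ∷ᶠ skip x ∘ h))
sumMaps-injections-∷ {G = G} ext = sum-cong-≗ λ x → begin
  sumMaps (λ g → 𝟙 (injective? (x ∷ᶠ g)) * G (x ∷ᶠ g))
    ≡⟨ sumMaps-cong (λ g → trans (cong (_* G (x ∷ᶠ g)) (𝟙-injective-∷ x g))
                                  (*-assoc (𝟙 (avoids? x g)) (𝟙 (injective? g)) (G (x ∷ᶠ g)))) ⟩
  sumMaps (λ g → 𝟙 (avoids? x g) * (𝟙 (injective? g) * G (x ∷ᶠ g)))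
    ≡⟨ sumMaps-avoiding x (λ g≗h → cong₂ _*_ (𝟙-injective-cong g≗h) (ext (∷-cong x g≗h))) ⟩
  sumMaps (λ h → 𝟙 (injective? (skip x ∘ h)) * G (x ∷ᶠ skip x ∘ h))
    ≡⟨ sumMaps-cong (λ h → cong (_* G (x ∷ᶠ skip x ∘ h)) (𝟙-injective-∘ (skip-injective x) h)) ⟩
  sumMaps (λ h → 𝟙 (injective? h) * G (x ∷ᶠ skip x ∘ h)) ∎
  where open ≡-Reasoning

-- The requests of a faithful man

occurrences : Fin n → List (Fin n) → ℕ
occurrences x ws = List.sum (map (λ u → 𝟙 (x ≟ u)) ws)

∑-occurrences : (ws : List (Fin n)) → ∑[ x < n ] occurrences x ws ≡ length ws
∑-occurrences {n} []       = sum-replicate-zero n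
∑-occurrences     (u ∷ us) =
  trans (∑-distrib-+ (λ x → 𝟙 (x ≟ u)) (λ x → occurrences x us))
        (cong₂ _+_ (∑-𝟙-≟ u) (∑-occurrences us))

occurrences-∉ : ∀ {x : Fin n} {ws} → All (x ≢_) ws → occurrences x ws ≡ 0
occurrences-∉         []                 = refl
occurrences-∉ {x = x} (_∷_ {u} x≢u x≢us) with x ≟ u
... | yes x≡u = contradiction x≡u x≢u
... | no  _   = occurrences-∉ x≢us

occurrences-≤1 : ∀ {x : Fin n} {ws} → Unique ws → occurrences x ws ≤ 1
occurrences-≤1         []                  = z≤n
occurrences-≤1 {x = x} (_∷_ {u} u≢us uniq) with x ≟ u
... | yes refl = s≤s (≤-reflexive (occurrences-∉ u≢us))
... | no  _    = occurrences-≤1 {x = x} uniq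

∑-occurrences-shift : ∀ (q : ℕ → ℕ) {ws : List (Fin n)} → Unique ws →
  ∑[ x < n ] q (length ws + occurrences x ws)
    ≡ (n ∸ length ws) * q (length ws) + length ws * q (suc (length ws))
∑-occurrences-shift {n} q {ws} uniq = begin
  ∑[ x < n ] q (L + b x)
    ≡⟨ sum-cong-≗ (λ x → split (b x) (occurrences-≤1 {x = x} uniq)) ⟩
  ∑[ x < n ] ((1 ∸ b x) * q L + b x * q (suc L))
    ≡⟨ ∑-distrib-+ (λ x → (1 ∸ b x) * q L) (λ x → b x * q (suc L)) ⟩
  ∑[ x < n ] ((1 ∸ b x) * q L) + ∑[ x < n ] (b x * q (suc L))
    ≡⟨ cong₂ _+_ (sym (*-distribʳ-sum (q L) (λ x → 1 ∸ b x))) (sym (*-distribʳ-sum (q (suc L)) b)) ⟩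
  ∑[ x < n ] (1 ∸ b x) * q L + ∑[ x < n ] b x * q (suc L)
    ≡⟨ cong₂ (λ s t → s * q L + t * q (suc L)) misses (∑-occurrences ws) ⟩
  (n ∸ L) * q L + L * q (suc L) ∎
  where
  open ≡-Reasoning
  L = length ws
  b = λ x → occurrences x ws
  split : ∀ k → k ≤ 1 → q (L + k) ≡ (1 ∸ k) * q L + k * q (suc L)
  split 0 _ = trans (cong q (+-identityʳ L)) (sym (trans (+-identityʳ _) (+-identityʳ (q L))))
  split 1 _ = trans (cong q (+-comm L 1)) (sym (+-identityʳ (q (suc L))))
  split (suc (suc _)) (s≤s ())
  misses : ∑[ x < n ] (1 ∸ b x) ≡ n ∸ L
  misses = begin
    ∑[ x < n ] (1 ∸ b x)                       ≡⟨ m+n∸n≡m _ L ⟨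
    ∑[ x < n ] (1 ∸ b x) + L ∸ L
      ≡⟨ cong (λ s → ∑[ x < n ] (1 ∸ b x) + s ∸ L) (∑-occurrences ws) ⟨
    ∑[ x < n ] (1 ∸ b x) + ∑[ x < n ] b x ∸ L  ≡⟨ cong (_∸ L) (∑-distrib-+ (λ x → 1 ∸ b x) b) ⟨
    ∑[ x < n ] (1 ∸ b x + b x) ∸ L
      ≡⟨ cong (_∸ L) (sum-cong-≗ (λ x → m∸n+n≡m (occurrences-≤1 {x = x} uniq))) ⟩
    ∑[ x < n ] 1 ∸ L                           ≡⟨ cong (_∸ L) (∑-1 n) ⟩
    n ∸ L                                      ∎

lookup-injective : ∀ {A : Set} {ws : List A} → Unique ws → Injective _≡_ _≡_ (lookupL ws)
lookup-injective (w≢ws ∷ uniq) {zero}  {zero}  _  = refl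
lookup-injective (w≢ws ∷ uniq) {zero}  {suc j} eq = contradiction eq (All.lookup w≢ws (∈-lookup j))
lookup-injective (w≢ws ∷ uniq) {suc i} {zero}  eq = contradiction (sym eq) (All.lookup w≢ws (∈-lookup i))
lookup-injective (w≢ws ∷ uniq) {suc i} {suc j} eq = cong suc (lookup-injective uniq eq)

unique-length≤ : {ws : List (Fin n)} → Unique ws → length ws ≤ n
unique-length≤ uniq = injective⇒≤ (lookup-injective uniq)

preimage-sound : ∀ (M : Fin k → Fin n) {w j} → preimage M w ≡ just j → M j ≡ w
preimage-sound {suc k} M {w} e with M zero ≟ w
preimage-sound {suc k} M {j = zero} refl | yes M0≡w = M0≡w
... | no _ with preimage (M ∘ suc) w in e′
preimage-sound {suc k} M {j = suc j} refl | no _ | just j = preimage-sound (M ∘ suc) e′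

preimage-cong : ∀ {M M′ : Fin k → Fin n} → M ≗ M′ → ∀ w → preimage M w ≡ preimage M′ w
preimage-cong {zero}                 M≗M′ w = refl
preimage-cong {suc k} {M = M} {M′} M≗M′ w with M zero ≟ w | M′ zero ≟ w
... | yes _    | yes _     = refl
... | yes M0≡w | no M′0≢w  = contradiction (trans (sym (M≗M′ zero)) M0≡w) M′0≢w
... | no M0≢w  | yes M′0≡w = contradiction (trans (M≗M′ zero) M′0≡w) M0≢w
... | no _     | no _      = cong (Maybe.map suc) (preimage-cong (M≗M′ ∘ suc) w)

preimage-∘ : ∀ {p} {e : Fin n → Fin p} → Injective _≡_ _≡_ e → (h : Fin k → Fin n) → ∀ z →
             preimage (e ∘ h) (e z) ≡ preimage h z
preimage-∘ {k = zero}          e-inj h z = refl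
preimage-∘ {k = suc k} {e = e} e-inj h z with e (h zero) ≟ e z | h zero ≟ z
... | yes _      | yes _    = refl
... | yes eh0≡ez | no h0≢z  = contradiction (e-inj eh0≡ez) h0≢z
... | no eh0≢ez  | yes h0≡z = contradiction (cong e h0≡z) eh0≢ez
... | no _       | no _     = cong (Maybe.map suc) (preimage-∘ e-inj (h ∘ suc) z)

preimage-∷-≡ : ∀ {x w : Fin n} (g : Fin k → Fin n) → x ≡ w → preimage (x ∷ᶠ g) w ≡ just zero
preimage-∷-≡ {x = x} {w} g x≡w with x ≟ w
... | yes _  = refl
... | no x≢w = contradiction x≡w x≢w

preimage-∷-≢ : ∀ {x w : Fin n} (g : Fin k → Fin n) → x ≢ w →
               preimage (x ∷ᶠ g) w ≡ Maybe.map suc (preimage g w)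
preimage-∷-≢ {x = x} {w} g x≢w with x ≟ w
... | yes x≡w = contradiction x≡w x≢w
... | no _    = refl

requestsFrom-cong : ∀ {M M′ : Fin c → Fin (c + f)} → M ≗ M′ → ∀ k w →
                    requestsFrom k M w ≡ requestsFrom k M′ w
requestsFrom-cong                      M≗M′ zero    w = refl
requestsFrom-cong {f = f} {M = M} {M′} M≗M′ (suc k) w
  with preimage M w | preimage M′ w | preimage-cong M≗M′ w
... | nothing | .nothing  | refl = refl
... | just j  | .(just j) | refl = cong suc (requestsFrom-cong M≗M′ k (j ↑ˡ f))

data Requests (f : ℕ) {c} (M : Fin c → Fin (c + f)) : Fin (c + f) → List (Fin (c + f)) → Set where
  accept   : ∀ {w} → preimage M w ≡ nothing → Requests f M w (w ∷ [])
  redirect : ∀ {w j ws} → preimage M w ≡ just j → Requests f M (j ↑ˡ f) ws →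
             Requests f M w (w ∷ ws)

requestsFrom-Requests : ∀ {M : Fin c → Fin (c + f)} {w ws} → Requests f M w ws →
                        ∀ k → length ws ≤ k → requestsFrom k M w ≡ length ws
requestsFrom-Requests (accept e)     (suc k) _          rewrite e = refl
requestsFrom-Requests (redirect e r) (suc k) (s≤s ws≤k) rewrite e =
  cong suc (requestsFrom-Requests r k ws≤k)

-- Every woman asked is w₀ or the wife of the lover of an earlier one; as distinct women have
-- distinct lovers and w₀ is nobody's wife, no woman is asked twice, so at most c + f are asked.
module _ (M : Fin c → Fin (c + f)) (w₀ : Fin (c + f)) (w₀-unmarried : ∀ j → j ↑ˡ f ≢ w₀) where

  private
    Explained : List (Fin (c + f)) → Fin (c + f) → Set
    Explained P w = w ≡ w₀ ⊎ ∃₂ λ p j → p ∈ P × preimage M p ≡ just j × w ≡ j ↑ˡ f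

    weaken : ∀ {v P w} → Explained P w → Explained (v ∷ P) w
    weaken (inj₁ w≡w₀)                = inj₁ w≡w₀
    weaken (inj₂ (p , j , p∈P , rest)) = inj₂ (p , j , there p∈P , rest)

    explore : ∀ k P v → Unique (v ∷ P) → All (Explained P) (v ∷ P) → c + f ≤ length P + k →
              ∃ λ ws → Requests f M v ws × Unique ws × All (_∉ P) ws
    explore zero P v uniq _ c+f≤ =
      contradiction (≤-trans (unique-length≤ uniq) (subst (c + f ≤_) (+-identityʳ _) c+f≤)) 1+n≰n
    explore (suc k) P v (v∉P ∷ uniq) expl c+f≤ with preimage M v in e
    ... | nothing = v ∷ [] , accept e , [] ∷ [] , All¬⇒¬Any v∉P ∷ []
    ... | just j  =
      let ws , r , uniq′ , ws∉vP = explore k (v ∷ P) (j ↑ˡ f) (¬Any⇒All¬ (v ∷ P) next∉ ∷ v∉P ∷ uniq)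
                                           (inj₂ (v , j , here refl , e , refl) ∷ All.map weaken expl)
                                           (subst (c + f ≤_) (+-suc (length P) k) c+f≤)
      in v ∷ ws , redirect e r ,
         All.map (λ w∉vP v≡w → w∉vP (here (sym v≡w))) ws∉vP ∷ uniq′ ,
         All¬⇒¬Any v∉P ∷ All.map (λ w∉vP w∈P → w∉vP (there w∈P)) ws∉vP
      where
      next∉ : j ↑ˡ f ∉ v ∷ P
      next∉ mem with All.lookup expl mem
      ... | inj₁ wife≡w₀ = w₀-unmarried j wife≡w₀
      ... | inj₂ (p , j′ , p∈P , e′ , wife≡wife′) with ↑ˡ-injective f j j′ wife≡wife′
      ... | refl = All¬⇒¬Any v∉P
                     (subst (_∈ P) (trans (sym (preimage-sound M e′)) (preimage-sound M e)) p∈P)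

  requests-exist : ∃ λ ws → Requests f M w₀ ws × Unique ws
  requests-exist with explore (c + f) [] w₀ ([] ∷ []) (inj₁ refl ∷ []) ≤-refl
  ... | ws , r , uniq , _ = ws , r , uniq

↑ˡ≢↑ʳ : ∀ (j : Fin c) (y : Fin f) → j ↑ˡ f ≢ c ↑ʳ y
↑ˡ≢↑ʳ {c} {f} j y eq with trans (sym (splitAt-↑ˡ c j f)) (trans (cong (splitAt c) eq) (splitAt-↑ʳ c f y))
... | ()

detour : Fin (suc n) → List (Fin n) → List (Fin (suc n))
detour x []       = []
detour x (u ∷ us) with x ≟ suc u
... | yes _ = suc u ∷ zero ∷ detour x us
... | no  _ = suc u ∷ detour x us

length-detour : ∀ x (ws : List (Fin n)) → length (detour x ws) ≡ length ws + occurrences x (map suc ws)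
length-detour x []       = refl
length-detour x (u ∷ us) with x ≟ suc u
... | yes _ = cong suc (trans (cong suc (length-detour x us)) (sym (+-suc (length us) _)))
... | no  _ = cong suc (length-detour x us)

module _ (h : Fin c → Fin (c + f)) (x : Fin (suc (c + f))) where

  private
    shifted : ∀ {v w r} → w ≡ skip x v → preimage h v ≡ r →
              preimage (x ∷ᶠ skip x ∘ h) w ≡ Maybe.map suc r
    shifted {v} refl refl =
      trans (preimage-∷-≢ (skip x ∘ h) (skip-avoids x v ∘ sym))
            (cong (Maybe.map suc) (preimage-∘ (skip-injective x) h v))

  -- Mrs. x now has Mr. 0 as her lover, so right after asking her the man asks Mrs. 0, who has
  -- taken over the old lover of Mrs. x; otherwise the requests are the old ones, relabelled.
  requests-detour : ∀ {v ws} → Requests f h v ws → Requests f (x ∷ᶠ skip x ∘ h) (suc v) (detour x ws)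
  requests-detour (accept {v} e) with x ≟ suc v
  ... | yes x≡1+v = redirect (preimage-∷-≡ (skip x ∘ h) x≡1+v)
                             (accept (shifted (sym (skip-hit (sym x≡1+v))) e))
  ... | no  x≢1+v = accept (shifted (sym (skip-miss (x≢1+v ∘ sym))) e)
  requests-detour (redirect {v} e r) with x ≟ suc v
  ... | yes x≡1+v = redirect (preimage-∷-≡ (skip x ∘ h) x≡1+v)
                             (redirect (shifted (sym (skip-hit (sym x≡1+v))) e) (requests-detour r))
  ... | no  x≢1+v = redirect (shifted (sym (skip-miss (x≢1+v ∘ sym))) e) (requests-detour r)

-- The Pólya urn

-- One draw from an urn of m + 1 balls, r of them red: with weight r a red one is drawn and r grows by one.
step : ℕ → (ℕ → ℕ) → ℕ → ℕ
step m q r = (suc m ∸ r) * q r + r * q (suc r)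

polya : ℕ → ℕ → (ℕ → ℕ) → ℕ
polya f zero    q = q 1
polya f (suc c) q = polya f c (step (c + f) q)

∑-requests-extension : ∀ (h : Fin c → Fin (c + f)) (y : Fin f) (q : ℕ → ℕ) →
  ∑[ x < suc (c + f) ] q (requestsFrom (suc (c + f)) (x ∷ᶠ skip x ∘ h) (suc (c ↑ʳ y)))
    ≡ step (c + f) q (requestsFrom (c + f) h (c ↑ʳ y))
∑-requests-extension {c} {f} h y q with requests-exist h (c ↑ʳ y) (λ j → ↑ˡ≢↑ʳ j y)
... | ws , r , uniq = begin
  ∑[ x < suc (c + f) ] q (requestsFrom (suc (c + f)) (x ∷ᶠ skip x ∘ h) (suc (c ↑ʳ y)))
    ≡⟨ sum-cong-≗ (λ x → cong q (new x)) ⟩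
  ∑[ x < suc (c + f) ] q (L + occurrences x (map suc ws))
    ≡⟨ ∑-occurrences-shift q uniq′ ⟩
  step (c + f) q L
    ≡⟨ cong (step (c + f) q) (trans (length-map suc ws) (sym old)) ⟩
  step (c + f) q (requestsFrom (c + f) h (c ↑ʳ y)) ∎
  where
  open ≡-Reasoning
  L = length (map suc ws)
  uniq′ : Unique (map suc ws)
  uniq′ = Unique.map⁺ suc-injective uniq
  L≤ : length ws ≤ c + f
  L≤ = unique-length≤ uniq
  old : requestsFrom (c + f) h (c ↑ʳ y) ≡ length ws
  old = requestsFrom-Requests r (c + f) L≤
  new : ∀ x → requestsFrom (suc (c + f)) (x ∷ᶠ skip x ∘ h) (suc (c ↑ʳ y)) ≡ L + occurrences x (map suc ws)
  new x = trans (requestsFrom-Requests (requests-detour h x r) (suc (c + f)) bound)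
                (trans (length-detour x ws) (cong (_+ occurrences x (map suc ws)) (sym (length-map suc ws))))
    where
    bound : length (detour x ws) ≤ suc (c + f)
    bound = subst (_≤ suc (c + f)) (sym (length-detour x ws))
                  (≤-trans (+-monoʳ-≤ (length ws) (occurrences-≤1 {x = x} uniq′))
                           (subst (_≤ suc (c + f)) (+-comm 1 (length ws)) (s≤s L≤)))

sum-requests : ∀ c (y : Fin f) (q : ℕ → ℕ) →
  sumMaps {c} (λ M → 𝟙 (injective? M) * q (requestsFrom {c} {f} (c + f) M (c ↑ʳ y))) ≡ polya f c q
sum-requests {suc f} zero y q =
  trans (cong (_* q 1) (𝟙-yes (λ {}) (injective? {0} {suc f} (λ ())))) (+-identityʳ (q 1))
sum-requests {f} (suc c) y q = begin
  sumMaps {suc c} {suc (c + f)} (λ M → 𝟙 (injective? M) * q (R′ M))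
    ≡⟨ sumMaps-injections-∷ {c} {c + f}
         (λ M≗M′ → cong q (requestsFrom-cong M≗M′ (suc (c + f)) (suc c ↑ʳ y))) ⟩
  ∑[ x < suc (c + f) ] sumMaps {c} (λ h → 𝟙 (injective? h) * q (R′ (x ∷ᶠ skip x ∘ h)))
    ≡⟨ ∑-sumMaps-comm (λ x h → 𝟙 (injective? h) * q (R′ (x ∷ᶠ skip x ∘ h))) ⟩
  sumMaps {c} (λ h → ∑[ x < suc (c + f) ] (𝟙 (injective? h) * q (R′ (x ∷ᶠ skip x ∘ h))))
    ≡⟨ sumMaps-cong (λ h →
         trans (sym (*-distribˡ-sum (𝟙 (injective? h)) (λ x → q (R′ (x ∷ᶠ skip x ∘ h)))))
               (cong (𝟙 (injective? h) *_) (∑-requests-extension h y q))) ⟩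
  sumMaps {c} (λ h → 𝟙 (injective? h) * step (c + f) q (requestsFrom {c} {f} (c + f) h (c ↑ʳ y)))
    ≡⟨ sum-requests c y (step (c + f) q) ⟩
  polya f c (step (c + f) q) ∎
  where
  open ≡-Reasoning
  R′ : (Fin (suc c) → Fin (suc c + f)) → ℕ
  R′ M = requestsFrom {suc c} {f} (suc c + f) M (suc c ↑ʳ y)

sum-map-requests : ∀ c (y : Fin f) (q : ℕ → ℕ) →
  List.sum (map (λ M → q (requestsFrom (c + f) M (c ↑ʳ y))) (injections c f)) ≡ polya f c q
sum-map-requests {f} c y q =
  trans (sum-map-injections {c} {f} (λ M → q (requestsFrom (c + f) M (c ↑ʳ y)))) (sum-requests c y q)

polya-cong : ∀ c {q q′ : ℕ → ℕ} → (∀ r → 1 ≤ r → r ≤ suc c → q r ≡ q′ r) → polya f c q ≡ polya f c q′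
polya-cong     zero    q≗q′ = q≗q′ 1 ≤-refl ≤-refl
polya-cong {f} (suc c) q≗q′ = polya-cong c λ r 1≤r r≤1+c →
  cong₂ _+_ (cong ((suc (c + f) ∸ r) *_) (q≗q′ r 1≤r (m≤n⇒m≤1+n r≤1+c)))
            (cong (r *_) (q≗q′ (suc r) (s≤s z≤n) (s≤s r≤1+c)))

polya-linear : ∀ c a b (q q′ : ℕ → ℕ) →
  polya f c (λ r → a * q r + b * q′ r) ≡ a * polya f c q + b * polya f c q′
polya-linear     zero    a b q q′ = refl
polya-linear {f} (suc c) a b q q′ =
  trans (polya-cong c (λ r _ _ → distrib a b (suc (c + f) ∸ r) r (q r) (q′ r) (q (suc r)) (q′ (suc r))))
        (polya-linear c a b (step (c + f) q) (step (c + f) q′))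
  where
  distrib : ∀ a b d r x x′ y y′ →
            d * (a * x + b * x′) + r * (a * y + b * y′) ≡ a * (d * x + r * y) + b * (d * x′ + r * y′)
  distrib = solve-∀

polya-scale : ∀ c a (q : ℕ → ℕ) → polya f c (λ r → a * q r) ≡ a * polya f c q
polya-scale c a q = trans (polya-cong c (λ r _ _ → sym (+-identityʳ (a * q r))))
                          (trans (polya-linear c a 0 q q) (+-identityʳ _))

polya-zero : ∀ c → polya f c (λ _ → 0) ≡ 0
polya-zero c = polya-linear c 0 0 (λ _ → 0) (λ _ → 0)

rising : ℕ → ℕ → ℕ
rising r zero    = 1
rising r (suc p) = r * rising (suc r) p

rising-suc : ∀ r p → rising r (suc p) ≡ rising r p * (r + p)
rising-suc r zero    = trans (*-identityʳ r) (sym (trans (+-identityʳ (r + 0)) (+-identityʳ r)))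
rising-suc r (suc p) = begin
  r * rising (suc r) (suc p)           ≡⟨ cong (r *_) (rising-suc (suc r) p) ⟩
  r * (rising (suc r) p * suc (r + p)) ≡⟨ *-assoc r _ _ ⟨
  r * rising (suc r) p * suc (r + p)   ≡⟨ cong (r * rising (suc r) p *_) (+-suc r p) ⟨
  r * rising (suc r) p * (r + suc p)   ∎
  where open ≡-Reasoning

rising-1 : ∀ p → rising 1 p ≡ p !
rising-1 zero    = refl
rising-1 (suc p) = trans (rising-suc 1 p) (trans (cong (_* suc p) (rising-1 p)) (*-comm (p !) (suc p)))

step-rising : ∀ m p r → r ≤ suc m → step m (λ r → rising r p) r ≡ (suc m + p) * rising r p
step-rising m p r r≤1+m = begin
  (suc m ∸ r) * rising r p + rising r (suc p)     ≡⟨ cong ((suc m ∸ r) * rising r p +_) (rising-suc r p) ⟩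
  (suc m ∸ r) * rising r p + rising r p * (r + p) ≡⟨ regroup (suc m ∸ r) r p (rising r p) ⟩
  (suc m ∸ r + r + p) * rising r p                ≡⟨ cong (λ s → (s + p) * rising r p) (m∸n+n≡m r≤1+m) ⟩
  (suc m + p) * rising r p                        ∎
  where
  open ≡-Reasoning
  regroup : ∀ d r p x → d * x + x * (r + p) ≡ (d + r + p) * x
  regroup = solve-∀

polya-step-rising : ∀ c p →
  polya f (suc c) (λ r → rising r p) ≡ (suc (c + f) + p) * polya f c (λ r → rising r p)
polya-step-rising {f} c p =
  trans (polya-cong c (λ r _ r≤1+c → step-rising (c + f) p r (≤-trans r≤1+c (s≤s (m≤m+n c f)))))
        (polya-scale c (suc (c + f) + p) (λ r → rising r p))

polya-count : ∀ c → polya f c (λ _ → 1) * f ! ≡ (c + f) !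
polya-count         zero    = +-identityʳ _
polya-count {f} (suc c) = begin
  polya f (suc c) (λ _ → 1) * f !                    ≡⟨ cong (_* f !) (polya-step-rising c 0) ⟩
  (suc (c + f) + 0) * polya f c (λ _ → 1) * f !      ≡⟨ *-assoc (suc (c + f) + 0) (polya f c (λ _ → 1)) (f !) ⟩
  (suc (c + f) + 0) * (polya f c (λ _ → 1) * f !)    ≡⟨ cong₂ _*_ (+-identityʳ (suc (c + f))) (polya-count c) ⟩
  suc (c + f) ! ∎
  where open ≡-Reasoning

polya-rising : ∀ c p → polya f c (λ r → rising r p) * rising (suc f) p
                        ≡ p ! * rising (suc (c + f)) p * polya f c (λ _ → 1)
polya-rising {f} zero p = begin
  rising 1 p * rising (suc f) p  ≡⟨ cong (_* rising (suc f) p) (rising-1 p) ⟩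
  p ! * rising (suc f) p         ≡⟨ *-identityʳ _ ⟨
  p ! * rising (suc f) p * 1     ∎
  where open ≡-Reasoning
polya-rising {f} (suc c) p = begin
  polya f (suc c) (λ r → rising r p) * rising (suc f) p
    ≡⟨ cong (_* rising (suc f) p) (polya-step-rising c p) ⟩
  (suc m + p) * polya f c (λ r → rising r p) * rising (suc f) p
    ≡⟨ *-assoc (suc m + p) (polya f c (λ r → rising r p)) (rising (suc f) p) ⟩
  (suc m + p) * (polya f c (λ r → rising r p) * rising (suc f) p)
    ≡⟨ cong ((suc m + p) *_) (polya-rising c p) ⟩
  (suc m + p) * (p ! * rising (suc m) p * N)
    ≡⟨ shuffle (suc m + p) (p !) (rising (suc m) p) N ⟩
  p ! * (rising (suc m) p * (suc m + p)) * N
    ≡⟨ cong (λ x → p ! * x * N) (rising-suc (suc m) p) ⟨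
  p ! * (suc m * rising (suc (suc m)) p) * N
    ≡⟨ shuffle′ (p !) (suc m) (rising (suc (suc m)) p) N ⟩
  p ! * rising (suc (suc m)) p * (suc m * N)
    ≡⟨ cong (λ x → p ! * rising (suc (suc m)) p * (x * N)) (+-identityʳ (suc m)) ⟨
  p ! * rising (suc (suc m)) p * ((suc m + 0) * N)
    ≡⟨ cong (p ! * rising (suc (suc m)) p *_) (polya-step-rising c 0) ⟨
  p ! * rising (suc (suc m)) p * polya f (suc c) (λ _ → 1) ∎
  where
  open ≡-Reasoning
  m = c + f
  N = polya f c (λ _ → 1)
  shuffle : ∀ a x y z → a * (x * y * z) ≡ x * (y * a) * z
  shuffle = solve-∀
  shuffle′ : ∀ x a y z → x * (a * y) * z ≡ x * y * (a * z)
  shuffle′ = solve-∀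

polya-mean : ∀ c → polya f c (λ r → r) * (f + 1) ≡ (c + f + 1) * polya f c (λ _ → 1)
polya-mean {f} c = begin
  polya f c (λ r → r) * (f + 1)
    ≡⟨ cong₂ _*_ (polya-cong c (λ r _ _ → sym (*-identityʳ r))) (first f) ⟩
  polya f c (λ r → rising r 1) * rising (suc f) 1
    ≡⟨ polya-rising c 1 ⟩
  1 ! * rising (suc (c + f)) 1 * polya f c (λ _ → 1)
    ≡⟨ cong (_* polya f c (λ _ → 1)) (trans (first (c + f)) (sym (+-identityʳ (suc (c + f) * 1)))) ⟨
  (c + f + 1) * polya f c (λ _ → 1) ∎
  where
  open ≡-Reasoning
  first : ∀ m → m + 1 ≡ suc m * 1
  first = solve-∀

polya-second : ∀ c → (polya f c (λ r → r * r) + polya f c (λ r → r)) * ((f + 1) * (f + 2))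
                     ≡ 2 * (c + f + 1) * (c + f + 2) * polya f c (λ _ → 1)
polya-second {f} c = begin
  (polya f c (λ r → r * r) + polya f c (λ r → r)) * ((f + 1) * (f + 2))
    ≡⟨ cong₂ _*_ sum-rising (second f) ⟩
  polya f c (λ r → rising r 2) * rising (suc f) 2
    ≡⟨ polya-rising c 2 ⟩
  2 ! * rising (suc (c + f)) 2 * polya f c (λ _ → 1)
    ≡⟨ cong (_* polya f c (λ _ → 1)) (second′ (c + f)) ⟨
  2 * (c + f + 1) * (c + f + 2) * polya f c (λ _ → 1) ∎
  where
  open ≡-Reasoning
  second : ∀ m → (m + 1) * (m + 2) ≡ suc m * (suc (suc m) * 1)
  second = solve-∀
  second′ : ∀ m → 2 * (m + 1) * (m + 2) ≡ 2 * (suc m * (suc (suc m) * 1))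
  second′ = solve-∀
  square+ : ∀ r → 1 * (r * r) + 1 * r ≡ r * (suc r * 1)
  square+ = solve-∀
  sum-rising : polya f c (λ r → r * r) + polya f c (λ r → r) ≡ polya f c (λ r → rising r 2)
  sum-rising = begin
    polya f c (λ r → r * r) + polya f c (λ r → r)
      ≡⟨ cong₂ _+_ (+-identityʳ (polya f c (λ r → r * r))) (+-identityʳ (polya f c (λ r → r))) ⟨
    1 * polya f c (λ r → r * r) + 1 * polya f c (λ r → r)
      ≡⟨ polya-linear c 1 1 (λ r → r * r) (λ r → r) ⟨
    polya f c (λ r → 1 * (r * r) + 1 * r)
      ≡⟨ polya-cong c (λ r _ _ → square+ r) ⟩
    polya f c (λ r → rising r 2) ∎

-- With E R = S₁ / N and E[R (R + 1)] = (S₂ + S₁) / N this is Var R = E[R²] − (E R)² cleared of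
-- denominators; it rests on 2 (c + f + 2)(f + 1) − (f + 1)(f + 2) − (c + f + 1)(f + 2) = c f.
variance-identity : ∀ c f N S₁ S₂ → S₁ * (f + 1) ≡ (c + f + 1) * N →
  (S₂ + S₁) * ((f + 1) * (f + 2)) ≡ 2 * (c + f + 1) * (c + f + 2) * N →
  S₂ * N * ((f + 1) * (f + 1) * (f + 2)) ≡ (c + f + 1) * c * f * N * N + S₁ * S₁ * ((f + 1) * (f + 1) * (f + 2))
variance-identity c f N S₁ S₂ mean second = +-cancelʳ-≡ (S₁ * N * Q) _ _ (begin
  S₂ * N * Q + S₁ * N * Q
    ≡⟨ split S₂ S₁ N f ⟩
  (S₂ + S₁) * ((f + 1) * (f + 2)) * (N * (f + 1))
    ≡⟨ cong (_* (N * (f + 1))) second ⟩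
  2 * A * (c + f + 2) * N * (N * (f + 1))
    ≡⟨ expand c f N ⟩
  A * c * f * N * N + (A * N) * (A * N) * (f + 2) + (A * N) * N * ((f + 1) * (f + 2))
    ≡⟨ cong (λ x → A * c * f * N * N + x * x * (f + 2) + x * N * ((f + 1) * (f + 2))) mean ⟨
  A * c * f * N * N + (S₁ * (f + 1)) * (S₁ * (f + 1)) * (f + 2) + (S₁ * (f + 1)) * N * ((f + 1) * (f + 2))
    ≡⟨ collect (A * c * f * N * N) S₁ N f ⟩
  A * c * f * N * N + S₁ * S₁ * Q + S₁ * N * Q ∎)
  where
  open ≡-Reasoning
  A = c + f + 1
  Q = (f + 1) * (f + 1) * (f + 2)
  split : ∀ a b n f → a * n * ((f + 1) * (f + 1) * (f + 2)) + b * n * ((f + 1) * (f + 1) * (f + 2))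
                      ≡ (a + b) * ((f + 1) * (f + 2)) * (n * (f + 1))
  split = solve-∀
  expand : ∀ c f n → 2 * (c + f + 1) * (c + f + 2) * n * (n * (f + 1))
    ≡ (c + f + 1) * c * f * n * n + ((c + f + 1) * n) * ((c + f + 1) * n) * (f + 2)
      + ((c + f + 1) * n) * n * ((f + 1) * (f + 2))
  expand = solve-∀
  collect : ∀ x s n f → x + (s * (f + 1)) * (s * (f + 1)) * (f + 2) + (s * (f + 1)) * n * ((f + 1) * (f + 2))
    ≡ x + s * s * ((f + 1) * (f + 1) * (f + 2)) + s * n * ((f + 1) * (f + 1) * (f + 2))
  collect = solve-∀

polya-𝟙-suc : ∀ c j → polya f (suc c) (λ r → 𝟙 (r ≟ℕ suc j))
                      ≡ (c + f ∸ j) * polya f c (λ r → 𝟙 (r ≟ℕ suc j)) + j * polya f c (λ r → 𝟙 (r ≟ℕ j))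
polya-𝟙-suc {f} c j =
  trans (polya-cong c (λ r _ _ →
           cong₂ _+_ (*-𝟙-≟ (λ r → suc (c + f) ∸ r) r (suc j)) (*-𝟙-≟ (λ r → r) r j)))
        (polya-linear c (c + f ∸ j) j (λ r → 𝟙 (r ≟ℕ suc j)) (λ r → 𝟙 (r ≟ℕ j)))

polya-𝟙-beyond : ∀ c i → suc c < i → polya f c (λ r → 𝟙 (r ≟ℕ i)) ≡ 0
polya-𝟙-beyond c i 1+c<i =
  trans (polya-cong c (λ r _ r≤1+c → 𝟙-no (λ r≡i → <⇒≢ (≤-<-trans r≤1+c 1+c<i) r≡i) (r ≟ℕ i)))
        (polya-zero c)

!-+-suc : ∀ g t → (g + suc t) ! ≡ (g + suc t) * (g + t) !
!-+-suc g t rewrite +-suc g t = refl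

factorials-step : ∀ g t j x a b → a * (g ! * t !) ≡ x * (g + t) ! →
  j * (b * (g ! * suc t !)) ≡ j * (x * (g + suc t) !) →
  ((g + suc t) * a + j * b) * (g ! * suc t !) ≡ (j + suc t) * (x * (g + suc t) !)
factorials-step g t j x a b old older = begin
  ((g + suc t) * a + j * b) * (g ! * suc t !)
    ≡⟨ regroup (g + suc t) a j b (g !) t (t !) ⟩
  (g + suc t) * suc t * (a * (g ! * t !)) + j * (b * (g ! * suc t !))
    ≡⟨ cong₂ (λ y z → (g + suc t) * suc t * y + z) old older ⟩
  (g + suc t) * suc t * (x * (g + t) !) + j * (x * (g + suc t) !)
    ≡⟨ cong (λ y → (g + suc t) * suc t * (x * (g + t) !) + j * (x * y)) (!-+-suc g t) ⟩
  (g + suc t) * suc t * (x * (g + t) !) + j * (x * ((g + suc t) * (g + t) !))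
    ≡⟨ collect (g + suc t) t x ((g + t) !) j ⟩
  (j + suc t) * (x * ((g + suc t) * (g + t) !))
    ≡⟨ cong (λ y → (j + suc t) * (x * y)) (!-+-suc g t) ⟨
  (j + suc t) * (x * (g + suc t) !) ∎
  where
  open ≡-Reasoning
  regroup : ∀ u a j b x t y →
            (u * a + j * b) * (x * (suc t * y)) ≡ u * suc t * (a * (x * y)) + j * (b * (x * (suc t * y)))
  regroup = solve-∀
  collect : ∀ u t x y j → u * suc t * (x * y) + j * (x * (u * y)) ≡ (j + suc t) * (x * (u * y))
  collect = solve-∀

polya-𝟙-last : ∀ g c → polya (suc g) c (λ r → 𝟙 (r ≟ℕ suc c)) * (g ! * 1) ≡ c ! * (g + 0) ! →
               polya (suc g) (suc c) (λ r → 𝟙 (r ≟ℕ suc (suc c))) * (g ! * 1) ≡ suc c ! * (g + 0) !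
polya-𝟙-last g c previous = begin
  polya (suc g) (suc c) (λ r → 𝟙 (r ≟ℕ suc (suc c))) * (g ! * 1)
    ≡⟨ cong (_* (g ! * 1)) (polya-𝟙-suc c (suc c)) ⟩
  ((c + suc g ∸ suc c) * K (suc (suc c)) + suc c * K (suc c)) * (g ! * 1)
    ≡⟨ cong (λ k → ((c + suc g ∸ suc c) * k + suc c * K (suc c)) * (g ! * 1))
            (polya-𝟙-beyond c (suc (suc c)) ≤-refl) ⟩
  ((c + suc g ∸ suc c) * 0 + suc c * K (suc c)) * (g ! * 1)
    ≡⟨ cong (λ z → (z + suc c * K (suc c)) * (g ! * 1)) (*-zeroʳ (c + suc g ∸ suc c)) ⟩
  suc c * K (suc c) * (g ! * 1)
    ≡⟨ *-assoc (suc c) (K (suc c)) (g ! * 1) ⟩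
  suc c * (K (suc c) * (g ! * 1))
    ≡⟨ cong (suc c *_) previous ⟩
  suc c * (c ! * (g + 0) !)
    ≡⟨ *-assoc (suc c) (c !) _ ⟨
  suc c ! * (g + 0) ! ∎
  where
  open ≡-Reasoning
  K : ℕ → ℕ
  K i = polya (suc g) c (λ r → 𝟙 (r ≟ℕ i))

polya-𝟙 : ∀ g c j t → c ≡ j + t → polya (suc g) c (λ r → 𝟙 (r ≟ℕ suc j)) * (g ! * t !) ≡ c ! * (g + t) !
polya-𝟙 g zero zero zero refl =
  trans (+-identityʳ _) (trans (*-identityʳ (g !)) (sym (trans (+-identityʳ _) (cong _! (+-identityʳ g)))))
polya-𝟙 g (suc c) j zero 1+c≡j+0 with trans 1+c≡j+0 (+-identityʳ j)
... | refl = polya-𝟙-last g c (polya-𝟙 g c c 0 (sym (+-identityʳ c)))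
polya-𝟙 g (suc c) j (suc t) 1+c≡j+1+t = begin
  polya (suc g) (suc c) (λ r → 𝟙 (r ≟ℕ suc j)) * (g ! * suc t !)
    ≡⟨ cong (_* (g ! * suc t !)) (polya-𝟙-suc c j) ⟩
  ((c + suc g ∸ j) * K (suc j) + j * K j) * (g ! * suc t !)
    ≡⟨ cong (λ a → (a * K (suc j) + j * K j) * (g ! * suc t !)) weight ⟩
  ((g + suc t) * K (suc j) + j * K j) * (g ! * suc t !)
    ≡⟨ factorials-step g t j (c !) (K (suc j)) (K j) (polya-𝟙 g c j t c≡j+t) (earlier j 1+c≡j+1+t) ⟩
  (j + suc t) * (c ! * (g + suc t) !)
    ≡⟨ cong (λ y → y * (c ! * (g + suc t) !)) 1+c≡j+1+t ⟨
  suc c * (c ! * (g + suc t) !)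
    ≡⟨ *-assoc (suc c) (c !) _ ⟨
  suc c ! * (g + suc t) ! ∎
  where
  open ≡-Reasoning
  K : ℕ → ℕ
  K i = polya (suc g) c (λ r → 𝟙 (r ≟ℕ i))
  c≡j+t : c ≡ j + t
  c≡j+t = cong pred (trans 1+c≡j+1+t (+-suc j t))
  weight : c + suc g ∸ j ≡ g + suc t
  weight = begin
    c + suc g ∸ j       ≡⟨ cong (λ x → x + suc g ∸ j) c≡j+t ⟩
    j + t + suc g ∸ j   ≡⟨ cong (_∸ j) (+-assoc j t (suc g)) ⟩
    j + (t + suc g) ∸ j ≡⟨ m+n∸m≡n j (t + suc g) ⟩
    t + suc g           ≡⟨ +-comm t (suc g) ⟩
    suc g + t           ≡⟨ +-suc g t ⟨
    g + suc t           ∎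
  earlier : ∀ j → suc c ≡ j + suc t → j * (K j * (g ! * suc t !)) ≡ j * (c ! * (g + suc t) !)
  earlier zero     _            = refl
  earlier (suc j′) 1+c≡1+j′+1+t = cong (suc j′ *_) (polya-𝟙 g c j′ (suc t) (cong pred 1+c≡1+j′+1+t))

binomial-factorials : ∀ a b → ((a + b) C a) * (a ! * b !) ≡ (a + b) !
binomial-factorials a b =
  trans (cong (_* (a ! * b !)) (nCk≡n!/k![n-k]! (m≤m+n a b)))
        (cancel (m+n∸m≡n a b) (k![n∸k]!∣n! (m≤m+n a b)))
  where
  cancel : ∀ {d} → d ≡ b → a ! * d ! ∣ (a + b) ! →
           ((a + b) ! / (a ! * d !)) {{a !* d !≢0}} * (a ! * b !) ≡ (a + b) !
  cancel refl a!b!∣ = m/n*n≡m {{a !* b !≢0}} a!b!∣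

*≡!⇒1≤ : ∀ a b k → a * b ≡ k ! → 1 ≤ a
*≡!⇒1≤ zero    b k 0≡k! = contradiction (sym 0≡k!) (n>0⇒n≢0 (1≤n! k))
*≡!⇒1≤ (suc a) b k _    = s≤s z≤n

polya-distribution : ∀ g c i → 1 ≤ i → i ≤ c + 1 →
  polya (suc g) c (λ r → 𝟙 (r ≟ℕ i)) * ((c + suc g) C c) ≡ ((suc g + c ∸ i) C g) * polya (suc g) c (λ _ → 1)
polya-distribution g c (suc j) _ 1+j≤c+1 = *-cancelʳ-≡ _ _ X {{X≢0}} (begin
  K * ((c + suc g) C c) * X
    ≡⟨ regroup K ((c + suc g) C c) (g !) (t !) (c !) (suc g !) ⟩
  K * (g ! * t !) * (((c + suc g) C c) * (c ! * suc g !))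
    ≡⟨ cong₂ _*_ (polya-𝟙 g c j t c≡j+t) (binomial-factorials c (suc g)) ⟩
  c ! * (g + t) ! * (c + suc g) !
    ≡⟨ cong₂ (λ x y → c ! * x * y) (binomial-factorials g t) (polya-count c) ⟨
  c ! * (((g + t) C g) * (g ! * t !)) * (N * suc g !)
    ≡⟨ regroup′ (c !) ((g + t) C g) (g !) (t !) N (suc g !) ⟩
  ((g + t) C g) * N * X
    ≡⟨ cong (λ x → (x C g) * N * X) (+-∸-assoc g j≤c) ⟨
  ((g + c ∸ j) C g) * N * X ∎)
  where
  open ≡-Reasoning
  j≤c : j ≤ c
  j≤c = s≤s⁻¹ (subst (suc j ≤_) (+-comm c 1) 1+j≤c+1)
  t = c ∸ j
  c≡j+t : c ≡ j + t
  c≡j+t = sym (m+[n∸m]≡n j≤c)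
  K = polya (suc g) c (λ r → 𝟙 (r ≟ℕ suc j))
  N = polya (suc g) c (λ _ → 1)
  X = g ! * t ! * (c ! * suc g !)
  X≢0 : NonZero X
  X≢0 = m*n≢0 _ _ {{g !* t !≢0}} {{c !* suc g !≢0}}
  regroup : ∀ k b x y z w → k * b * (x * y * (z * w)) ≡ k * (x * y) * (b * (z * w))
  regroup = solve-∀
  regroup′ : ∀ z b x y n w → z * (b * (x * y)) * (n * w) ≡ b * n * (x * y * (z * w))
  regroup′ = solve-∀

-- Expectations over a finite list

ℕtoℚ≃ : ∀ n → toℚᵘ (ℕtoℚ n) ℚᵘ.≃ mkℚᵘ (ℤ.+ n) 0
ℕtoℚ≃ n = ℚ.toℚᵘ-fromℚᵘ (mkℚᵘ (ℤ.+ n) 0)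

ℕtoℚ-+ : ∀ m n → ℕtoℚ (m + n) ≡ ℕtoℚ m +ℚ ℕtoℚ n
ℕtoℚ-+ m n = ℚ.toℚᵘ-injective (begin
  toℚᵘ (ℕtoℚ (m + n))                   ≈⟨ ℕtoℚ≃ (m + n) ⟩
  mkℚᵘ (ℤ.+ (m + n)) 0                  ≈⟨ *≡* (cong (ℤ._* ℤ.+ 1) numerators) ⟩
  mkℚᵘ (ℤ.+ m) 0 ℚᵘ.+ mkℚᵘ (ℤ.+ n) 0    ≈⟨ ℚᵘ.+-cong (ℕtoℚ≃ m) (ℕtoℚ≃ n) ⟨
  toℚᵘ (ℕtoℚ m) ℚᵘ.+ toℚᵘ (ℕtoℚ n)     ≈⟨ ℚ.toℚᵘ-homo-+ (ℕtoℚ m) (ℕtoℚ n) ⟨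
  toℚᵘ (ℕtoℚ m +ℚ ℕtoℚ n)               ∎)
  where
  open ℚᵘ.≃-Reasoning
  numerators : ℤ.+ (m + n) ≡ ℤ.+ m ℤ.* ℤ.+ 1 ℤ.+ ℤ.+ n ℤ.* ℤ.+ 1
  numerators = trans (ℤ.pos-+ m n) (sym (cong₂ ℤ._+_ (ℤ.*-identityʳ (ℤ.+ m)) (ℤ.*-identityʳ (ℤ.+ n))))

ℕtoℚ-* : ∀ m n → ℕtoℚ (m * n) ≡ ℕtoℚ m *ℚ ℕtoℚ n
ℕtoℚ-* m n = ℚ.toℚᵘ-injective (begin
  toℚᵘ (ℕtoℚ (m * n))                   ≈⟨ ℕtoℚ≃ (m * n) ⟩
  mkℚᵘ (ℤ.+ (m * n)) 0                  ≈⟨ *≡* (cong (ℤ._* ℤ.+ 1) (ℤ.pos-* m n)) ⟩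
  mkℚᵘ (ℤ.+ m) 0 ℚᵘ.* mkℚᵘ (ℤ.+ n) 0    ≈⟨ ℚᵘ.*-cong (ℕtoℚ≃ m) (ℕtoℚ≃ n) ⟨
  toℚᵘ (ℕtoℚ m) ℚᵘ.* toℚᵘ (ℕtoℚ n)     ≈⟨ ℚ.toℚᵘ-homo-* (ℕtoℚ m) (ℕtoℚ n) ⟨
  toℚᵘ (ℕtoℚ m *ℚ ℕtoℚ n)               ∎)
  where open ℚᵘ.≃-Reasoning

ℕtoℚ-inverseʳ : ∀ n → ℕtoℚ (suc n) *ℚ (ℤ.+ 1 ℚ./ suc n) ≡ 1ℚ
ℕtoℚ-inverseʳ n = ℚ.toℚᵘ-injective (begin
  toℚᵘ (ℕtoℚ (suc n) *ℚ (ℤ.+ 1 ℚ./ suc n))           ≈⟨ ℚ.toℚᵘ-homo-* (ℕtoℚ (suc n)) _ ⟩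
  toℚᵘ (ℕtoℚ (suc n)) ℚᵘ.* toℚᵘ (ℤ.+ 1 ℚ./ suc n)
    ≈⟨ ℚᵘ.*-cong (ℕtoℚ≃ (suc n)) (ℚ.toℚᵘ-fromℚᵘ (mkℚᵘ (ℤ.+ 1) n)) ⟩
  mkℚᵘ (ℤ.+ suc n) 0 ℚᵘ.* mkℚᵘ (ℤ.+ 1) n             ≈⟨ *≡* (cong ℤ.+_ (cancel n)) ⟩
  toℚᵘ 1ℚ                                             ∎)
  where
  open ℚᵘ.≃-Reasoning
  cancel : ∀ n → suc n * 1 * 1 ≡ 1 * (1 * suc n)
  cancel = solve-∀

*-/ℕ : ∀ {q r} n → q *ℚ ℕtoℚ (suc n) ≡ r → q ≡ r /ℕ suc n
*-/ℕ {q} {r} n q*n≡r = begin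
  q                                          ≡⟨ ℚ.*-identityʳ q ⟨
  q *ℚ 1ℚ                                    ≡⟨ cong (q *ℚ_) (ℕtoℚ-inverseʳ n) ⟨
  q *ℚ (ℕtoℚ (suc n) *ℚ (ℤ.+ 1 ℚ./ suc n))   ≡⟨ ℚ.*-assoc q _ _ ⟨
  q *ℚ ℕtoℚ (suc n) *ℚ (ℤ.+ 1 ℚ./ suc n)     ≡⟨ cong (_*ℚ (ℤ.+ 1 ℚ./ suc n)) q*n≡r ⟩
  r /ℕ suc n                                 ∎
  where open ≡-Reasoning

*-cancelʳ-ℕtoℚ : ∀ {x y} n → x *ℚ ℕtoℚ (suc n) ≡ y *ℚ ℕtoℚ (suc n) → x ≡ y
*-cancelʳ-ℕtoℚ n eq = trans (*-/ℕ n refl) (trans (cong (_/ℕ suc n) eq) (sym (*-/ℕ n refl)))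

/ℕ-cross : ∀ a b d e → 1 ≤ d → 1 ≤ e → a * e ≡ b * d → ℕtoℚ a /ℕ d ≡ ℕtoℚ b /ℕ e
/ℕ-cross a b (suc d) (suc e) _ _ a*e≡b*d = *-/ℕ {r = ℕtoℚ b} e (*-cancelʳ-ℕtoℚ d (begin
  ℕtoℚ a *ℚ (ℤ.+ 1 ℚ./ suc d) *ℚ ℕtoℚ (suc e) *ℚ ℕtoℚ (suc d)
    ≡⟨ swap (ℕtoℚ a) _ (ℕtoℚ (suc e)) (ℕtoℚ (suc d)) ⟩
  ℕtoℚ a *ℚ ℕtoℚ (suc e) *ℚ (ℕtoℚ (suc d) *ℚ (ℤ.+ 1 ℚ./ suc d))
    ≡⟨ cong₂ _*ℚ_ (sym (ℕtoℚ-* a (suc e))) (ℕtoℚ-inverseʳ d) ⟩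
  ℕtoℚ (a * suc e) *ℚ 1ℚ
    ≡⟨ ℚ.*-identityʳ _ ⟩
  ℕtoℚ (a * suc e)
    ≡⟨ trans (cong ℕtoℚ a*e≡b*d) (ℕtoℚ-* b (suc d)) ⟩
  ℕtoℚ b *ℚ ℕtoℚ (suc d) ∎))
  where
  open ≡-Reasoning
  swap : ∀ x u y z → x *ℚ u *ℚ y *ℚ z ≡ x *ℚ y *ℚ (z *ℚ u)
  swap = solve 4 (λ x u y z → x :* u :* y :* z := x :* y :* (z :* u)) refl
    where open +-*-Solver

sumℚ-ℕtoℚ : ∀ {A : Set} (Y : A → ℕ) xs → sumℚ (map (λ a → ℕtoℚ (Y a)) xs) ≡ ℕtoℚ (List.sum (map Y xs))
sumℚ-ℕtoℚ Y []       = refl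
sumℚ-ℕtoℚ Y (x ∷ xs) = trans (cong (ℕtoℚ (Y x) +ℚ_) (sumℚ-ℕtoℚ Y xs)) (sym (ℕtoℚ-+ (Y x) _))

expect-ℕtoℚ : ∀ {A : Set} (Ω : List A) (Y : A → ℕ) →
              expect Ω (λ a → ℕtoℚ (Y a)) ≡ ℕtoℚ (List.sum (map Y Ω)) /ℕ length Ω
expect-ℕtoℚ Ω Y = cong (_/ℕ length Ω) (sumℚ-ℕtoℚ Y Ω)

-- The indicator in prob is local to its definition, so it is reached through prob Ω X i ≡ expect Ω F.
prob-as-expect : ∀ {A : Set} (Ω : List A) (X : A → ℕ) i →
                 prob Ω X i ≡ expect Ω (λ a → ℕtoℚ (𝟙 (X a ≟ℕ i)))
prob-as-expect {A} Ω X i = trans (proj₂ unfolded) (cong (λ xs → sumℚ xs /ℕ length Ω) (map-cong indicator Ω))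
  where
  unfolded : Σ (A → ℚ) λ F → prob Ω X i ≡ expect Ω F
  unfolded = _ , refl
  indicator : ∀ a → proj₁ unfolded a ≡ ℕtoℚ (𝟙 (X a ≟ℕ i))
  indicator a with X a ≟ℕ i
  ... | yes Xa≡i = cong ℕtoℚ (sym (𝟙-yes Xa≡i (X a ≟ℕ i)))
  ... | no  Xa≢i = cong ℕtoℚ (sym (𝟙-no Xa≢i (X a ≟ℕ i)))

sum-squared-deviations : ∀ {A : Set} (X : A → ℚ) μ xs →
  sumℚ (map (λ a → (X a -ℚ μ) *ℚ (X a -ℚ μ)) xs)
    ≡ sumℚ (map (λ a → X a *ℚ X a) xs) -ℚ (μ +ℚ μ) *ℚ sumℚ (map X xs) +ℚ ℕtoℚ (length xs) *ℚ μ *ℚ μ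
sum-squared-deviations X μ []       = empty μ
  where
  empty : ∀ μ → 0ℚ ≡ 0ℚ -ℚ (μ +ℚ μ) *ℚ 0ℚ +ℚ 0ℚ *ℚ μ *ℚ μ
  empty = solve 1 (λ μ → con 0ℚ := con 0ℚ :- (μ :+ μ) :* con 0ℚ :+ con 0ℚ :* μ :* μ) refl
    where open +-*-Solver
sum-squared-deviations X μ (x ∷ xs) = begin
  (X x -ℚ μ) *ℚ (X x -ℚ μ) +ℚ sumℚ (map (λ a → (X a -ℚ μ) *ℚ (X a -ℚ μ)) xs)
    ≡⟨ cong ((X x -ℚ μ) *ℚ (X x -ℚ μ) +ℚ_) (sum-squared-deviations X μ xs) ⟩
  (X x -ℚ μ) *ℚ (X x -ℚ μ) +ℚ (s₂ -ℚ (μ +ℚ μ) *ℚ s +ℚ ℓ *ℚ μ *ℚ μ)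
    ≡⟨ expand (X x) μ s s₂ ℓ ⟩
  (X x *ℚ X x +ℚ s₂) -ℚ (μ +ℚ μ) *ℚ (X x +ℚ s) +ℚ (1ℚ +ℚ ℓ) *ℚ μ *ℚ μ
    ≡⟨ cong (λ m → (X x *ℚ X x +ℚ s₂) -ℚ (μ +ℚ μ) *ℚ (X x +ℚ s) +ℚ m *ℚ μ *ℚ μ)
            (ℕtoℚ-+ 1 (length xs)) ⟨
  (X x *ℚ X x +ℚ s₂) -ℚ (μ +ℚ μ) *ℚ (X x +ℚ s) +ℚ ℕtoℚ (suc (length xs)) *ℚ μ *ℚ μ ∎
  where
  open ≡-Reasoning
  s = sumℚ (map X xs)
  s₂ = sumℚ (map (λ a → X a *ℚ X a) xs)
  ℓ = ℕtoℚ (length xs)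
  expand : ∀ y μ s s₂ n → (y -ℚ μ) *ℚ (y -ℚ μ) +ℚ (s₂ -ℚ (μ +ℚ μ) *ℚ s +ℚ n *ℚ μ *ℚ μ)
                          ≡ (y *ℚ y +ℚ s₂) -ℚ (μ +ℚ μ) *ℚ (y +ℚ s) +ℚ (1ℚ +ℚ n) *ℚ μ *ℚ μ
  expand = solve 5 (λ y μ s s₂ n → (y :- μ) :* (y :- μ) :+ (s₂ :- (μ :+ μ) :* s :+ n :* μ :* μ)
                                  := (y :* y :+ s₂) :- (μ :+ μ) :* (y :+ s) :+ (con 1ℚ :+ n) :* μ :* μ) refl
    where open +-*-Solver

variance-scaled : ∀ {A : Set} (Ω : List A) (X : A → ℚ) {n} → length Ω ≡ suc n →
  variance Ω X *ℚ (ℕtoℚ (suc n) *ℚ ℕtoℚ (suc n))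
    ≡ ℕtoℚ (suc n) *ℚ sumℚ (map (λ a → X a *ℚ X a) Ω) -ℚ sumℚ (map X Ω) *ℚ sumℚ (map X Ω)
variance-scaled Ω X {n} |Ω|≡1+n = begin
  variance Ω X *ℚ (N *ℚ N)
    ≡⟨ cong (λ L → (sumℚ (map (λ a → (X a -ℚ s /ℕ L) *ℚ (X a -ℚ s /ℕ L)) Ω) /ℕ L) *ℚ (N *ℚ N)) |Ω|≡1+n ⟩
  (sumℚ (map (λ a → (X a -ℚ μ) *ℚ (X a -ℚ μ)) Ω) /ℕ suc n) *ℚ (N *ℚ N)
    ≡⟨ cong (λ z → (z /ℕ suc n) *ℚ (N *ℚ N)) (sum-squared-deviations X μ Ω) ⟩
  ((s₂ -ℚ (μ +ℚ μ) *ℚ s +ℚ ℕtoℚ (length Ω) *ℚ μ *ℚ μ) /ℕ suc n) *ℚ (N *ℚ N)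
    ≡⟨ cong (λ L → ((s₂ -ℚ (μ +ℚ μ) *ℚ s +ℚ ℕtoℚ L *ℚ μ *ℚ μ) /ℕ suc n) *ℚ (N *ℚ N)) |Ω|≡1+n ⟩
  ((s₂ -ℚ (μ +ℚ μ) *ℚ s +ℚ N *ℚ μ *ℚ μ) /ℕ suc n) *ℚ (N *ℚ N)
    ≡⟨ collect s₂ s N u ⟩
  s₂ *ℚ N *ℚ (N *ℚ u) -ℚ s *ℚ s *ℚ (N *ℚ u +ℚ N *ℚ u) *ℚ (N *ℚ u)
    +ℚ s *ℚ s *ℚ (N *ℚ u) *ℚ (N *ℚ u) *ℚ (N *ℚ u)
    ≡⟨ cong (λ k → s₂ *ℚ N *ℚ k -ℚ s *ℚ s *ℚ (k +ℚ k) *ℚ k +ℚ s *ℚ s *ℚ k *ℚ k *ℚ k)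
            (ℕtoℚ-inverseʳ n) ⟩
  s₂ *ℚ N *ℚ 1ℚ -ℚ s *ℚ s *ℚ (1ℚ +ℚ 1ℚ) *ℚ 1ℚ +ℚ s *ℚ s *ℚ 1ℚ *ℚ 1ℚ *ℚ 1ℚ
    ≡⟨ simplify s₂ s N ⟩
  N *ℚ s₂ -ℚ s *ℚ s ∎
  where
  open ≡-Reasoning
  open +-*-Solver
  N = ℕtoℚ (suc n)
  u = ℤ.+ 1 ℚ./ suc n
  s = sumℚ (map X Ω)
  s₂ = sumℚ (map (λ a → X a *ℚ X a) Ω)
  μ = s /ℕ suc n
  collect : ∀ s₂ s N u → (s₂ -ℚ (s *ℚ u +ℚ s *ℚ u) *ℚ s +ℚ N *ℚ (s *ℚ u) *ℚ (s *ℚ u)) *ℚ u *ℚ (N *ℚ N)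
    ≡ s₂ *ℚ N *ℚ (N *ℚ u) -ℚ s *ℚ s *ℚ (N *ℚ u +ℚ N *ℚ u) *ℚ (N *ℚ u)
      +ℚ s *ℚ s *ℚ (N *ℚ u) *ℚ (N *ℚ u) *ℚ (N *ℚ u)
  collect = solve 4 (λ s₂ s N u → (s₂ :- (s :* u :+ s :* u) :* s :+ N :* (s :* u) :* (s :* u)) :* u :* (N :* N)
                    := s₂ :* N :* (N :* u) :- s :* s :* (N :* u :+ N :* u) :* (N :* u)
                       :+ s :* s :* (N :* u) :* (N :* u) :* (N :* u)) refl
  simplify : ∀ s₂ s N →
             s₂ *ℚ N *ℚ 1ℚ -ℚ s *ℚ s *ℚ (1ℚ +ℚ 1ℚ) *ℚ 1ℚ +ℚ s *ℚ s *ℚ 1ℚ *ℚ 1ℚ *ℚ 1ℚ ≡ N *ℚ s₂ -ℚ s *ℚ s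
  simplify = solve 3 (λ s₂ s N → s₂ :* N :* con 1ℚ :- s :* s :* (con 1ℚ :+ con 1ℚ) :* con 1ℚ
                                   :+ s :* s :* con 1ℚ :* con 1ℚ :* con 1ℚ := N :* s₂ :- s :* s) refl

variance-ℕtoℚ : ∀ {A : Set} (Ω : List A) (Y : A → ℕ) {S₁ S₂ N} P Q →
  List.sum (map Y Ω) ≡ S₁ → List.sum (map (λ a → Y a * Y a) Ω) ≡ S₂ → length Ω ≡ N → 1 ≤ N → 1 ≤ Q →
  S₂ * N * Q ≡ P * N * N + S₁ * S₁ * Q → variance Ω (λ a → ℕtoℚ (Y a)) ≡ ℕtoℚ P /ℕ Q
variance-ℕtoℚ Ω Y {S₁} {S₂} {suc n} P (suc q) refl refl |Ω|≡1+n _ _ identity =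
  *-/ℕ {r = ℕtoℚ P} q (*-cancelʳ-ℕtoℚ (n + n * suc n) (begin
    V *ℚ Q̂ *ℚ ℕtoℚ (suc n * suc n)
      ≡⟨ cong (V *ℚ Q̂ *ℚ_) (ℕtoℚ-* (suc n) (suc n)) ⟩
    V *ℚ Q̂ *ℚ (N̂ *ℚ N̂)
      ≡⟨ swap V Q̂ (N̂ *ℚ N̂) ⟩
    V *ℚ (N̂ *ℚ N̂) *ℚ Q̂
      ≡⟨ cong (_*ℚ Q̂) (variance-scaled Ω Ŷ |Ω|≡1+n) ⟩
    (N̂ *ℚ sumℚ (map (λ a → Ŷ a *ℚ Ŷ a) Ω) -ℚ sumℚ (map Ŷ Ω) *ℚ sumℚ (map Ŷ Ω)) *ℚ Q̂
      ≡⟨ cong₂ (λ x y → (N̂ *ℚ x -ℚ y *ℚ y) *ℚ Q̂) squares (sumℚ-ℕtoℚ Y Ω) ⟩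
    (N̂ *ℚ Ŝ₂ -ℚ Ŝ₁ *ℚ Ŝ₁) *ℚ Q̂
      ≡⟨ spread N̂ Ŝ₂ Ŝ₁ Q̂ ⟩
    Ŝ₂ *ℚ N̂ *ℚ Q̂ -ℚ Ŝ₁ *ℚ Ŝ₁ *ℚ Q̂
      ≡⟨ cong (_-ℚ Ŝ₁ *ℚ Ŝ₁ *ℚ Q̂) cast ⟩
    ℕtoℚ P *ℚ N̂ *ℚ N̂ +ℚ Ŝ₁ *ℚ Ŝ₁ *ℚ Q̂ -ℚ Ŝ₁ *ℚ Ŝ₁ *ℚ Q̂
      ≡⟨ cancel (ℕtoℚ P) N̂ (Ŝ₁ *ℚ Ŝ₁ *ℚ Q̂) ⟩
    ℕtoℚ P *ℚ (N̂ *ℚ N̂)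
      ≡⟨ cong (ℕtoℚ P *ℚ_) (ℕtoℚ-* (suc n) (suc n)) ⟨
    ℕtoℚ P *ℚ ℕtoℚ (suc n * suc n) ∎))
  where
  open ≡-Reasoning
  open +-*-Solver
  Ŷ = λ a → ℕtoℚ (Y a)
  V = variance Ω Ŷ
  N̂ = ℕtoℚ (suc n)
  Q̂ = ℕtoℚ (suc q)
  Ŝ₁ = ℕtoℚ S₁
  Ŝ₂ = ℕtoℚ S₂
  squares : sumℚ (map (λ a → Ŷ a *ℚ Ŷ a) Ω) ≡ Ŝ₂
  squares = trans (cong sumℚ (map-cong (λ a → sym (ℕtoℚ-* (Y a) (Y a))) Ω))
                  (sumℚ-ℕtoℚ (λ a → Y a * Y a) Ω)
  cast : Ŝ₂ *ℚ N̂ *ℚ Q̂ ≡ ℕtoℚ P *ℚ N̂ *ℚ N̂ +ℚ Ŝ₁ *ℚ Ŝ₁ *ℚ Q̂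
  cast = begin
    Ŝ₂ *ℚ N̂ *ℚ Q̂                                     ≡⟨ cong (_*ℚ Q̂) (ℕtoℚ-* S₂ (suc n)) ⟨
    ℕtoℚ (S₂ * suc n) *ℚ Q̂                           ≡⟨ ℕtoℚ-* (S₂ * suc n) (suc q) ⟨
    ℕtoℚ (S₂ * suc n * suc q)                        ≡⟨ cong ℕtoℚ identity ⟩
    ℕtoℚ (P * suc n * suc n + S₁ * S₁ * suc q)       ≡⟨ ℕtoℚ-+ (P * suc n * suc n) (S₁ * S₁ * suc q) ⟩
    ℕtoℚ (P * suc n * suc n) +ℚ ℕtoℚ (S₁ * S₁ * suc q)
      ≡⟨ cong₂ _+ℚ_ (trans (ℕtoℚ-* (P * suc n) (suc n)) (cong (_*ℚ N̂) (ℕtoℚ-* P (suc n))))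
                    (trans (ℕtoℚ-* (S₁ * S₁) (suc q)) (cong (_*ℚ Q̂) (ℕtoℚ-* S₁ S₁))) ⟩
    ℕtoℚ P *ℚ N̂ *ℚ N̂ +ℚ Ŝ₁ *ℚ Ŝ₁ *ℚ Q̂                ∎
  swap : ∀ v q m → v *ℚ q *ℚ m ≡ v *ℚ m *ℚ q
  swap = solve 3 (λ v q m → v :* q :* m := v :* m :* q) refl
  spread : ∀ n s₂ s₁ q → (n *ℚ s₂ -ℚ s₁ *ℚ s₁) *ℚ q ≡ s₂ *ℚ n *ℚ q -ℚ s₁ *ℚ s₁ *ℚ q
  spread = solve 4 (λ n s₂ s₁ q → (n :* s₂ :- s₁ :* s₁) :* q := s₂ :* n :* q :- s₁ :* s₁ :* q) refl
  cancel : ∀ p n x → p *ℚ n *ℚ n +ℚ x -ℚ x ≡ p *ℚ (n *ℚ n)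
  cancel = solve 3 (λ p n x → p :* n :* n :+ x :- x := p :* (n :* n)) refl

mainTheorem1 : (c f : ℕ) (hf : 1 ≤ f) →
    ((i : ℕ) → 1 ≤ i → i ≤ c + 1 →
      prob (injections c f) (R c f hf) i
        ≡ ℕtoℚ ((f + c ∸ i) C (f ∸ 1)) /ℕ ((c + f) C c))
    × (expect (injections c f) (λ M → ℕtoℚ (R c f hf M))
        ≡ ℕtoℚ (c + f + 1) /ℕ (f + 1))
    × (variance (injections c f) (λ M → ℕtoℚ (R c f hf M))
        ≡ ℕtoℚ ((c + f + 1) * c * f) /ℕ ((f + 1) * (f + 1) * (f + 2)))
mainTheorem1 c f@(suc g) hf@(s≤s z≤n) = distribution , mean , spread
  where
  Ω = injections c f
  X = R c f hf
  N = polya f c (λ _ → 1)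
  moment : ∀ q → List.sum (map (λ M → q (X M)) Ω) ≡ polya f c q
  moment = sum-map-requests c zero
  |Ω|≡N : length Ω ≡ N
  |Ω|≡N = trans (sym (sum-map-1 Ω)) (moment (λ _ → 1))
  1≤N : 1 ≤ N
  1≤N = *≡!⇒1≤ N (f !) (c + f) (polya-count c)
  expect-moment : ∀ q → expect Ω (λ M → ℕtoℚ (q (X M))) ≡ ℕtoℚ (polya f c q) /ℕ N
  expect-moment q = trans (expect-ℕtoℚ Ω (q ∘ X)) (cong₂ (λ a d → ℕtoℚ a /ℕ d) (moment q) |Ω|≡N)
  distribution : ∀ i → 1 ≤ i → i ≤ c + 1 → prob Ω X i ≡ ℕtoℚ ((f + c ∸ i) C g) /ℕ ((c + f) C c)
  distribution i 1≤i i≤c+1 =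
    trans (prob-as-expect Ω X i)
          (trans (expect-moment (λ r → 𝟙 (r ≟ℕ i)))
                 (/ℕ-cross (polya f c (λ r → 𝟙 (r ≟ℕ i))) ((f + c ∸ i) C g) N ((c + f) C c) 1≤N
                           (*≡!⇒1≤ ((c + f) C c) (c ! * f !) (c + f) (binomial-factorials c f))
                           (polya-distribution g c i 1≤i i≤c+1)))
  mean : expect Ω (λ M → ℕtoℚ (X M)) ≡ ℕtoℚ (c + f + 1) /ℕ (f + 1)
  mean = trans (expect-moment (λ r → r))
               (/ℕ-cross (polya f c (λ r → r)) (c + f + 1) N (f + 1) 1≤N (s≤s z≤n) (polya-mean c))
  spread : variance Ω (λ M → ℕtoℚ (X M)) ≡ ℕtoℚ ((c + f + 1) * c * f) /ℕ ((f + 1) * (f + 1) * (f + 2))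
  spread = variance-ℕtoℚ Ω X ((c + f + 1) * c * f) ((f + 1) * (f + 1) * (f + 2))
                         (moment (λ r → r)) (moment (λ r → r * r)) |Ω|≡N 1≤N (s≤s z≤n)
                         (variance-identity c f N (polya f c (λ r → r)) (polya f c (λ r → r * r))
                                            (polya-mean c) (polya-second c))
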